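{- Let $k_1,\dots,k_l\in\mathbb{N}$ with $k_j\mid k_{j-1}$ for $j=2,\dots,l$, and let $M\subset\mathbb{N}$ be the finite set with $\Lambda_{k_1}-\Lambda_{k_2}+\dots+(-1)^{l-1}\Lambda_{k_l}=\sum_{m\in M}\Psi_m$. Then either $M=\emptyset$, or $M$ has the following two properties: (1) $M$ contains a largest number $m_1$, and the directed graph $\mathcal{G}(M)$ has root $m_1$, i.e. every vertex of $\mathcal{G}(M)$ can be reached from $m_1$ along a directed path; (2) there is a chain of 2-edges in $\mathcal{G}(M)$ (vertices $c_0,c_1,\dots,c_r\in M$ with a 2-edge from $c_{i}$ to $c_{i+1}$ for each $i$) which meets every 2-plane of $\mathcal{G}(M)$.
   Context: $S^{UR}$ is the set of roots of unity; elements $\langle\zeta\rangle$ form a basis of the group ring $\mathbb{Z}\langle S^{UR}\rangle$. $\Lambda_m:=\sum_{a=0}^{m-1}\langle e^{2\pi ia/m}\rangle$ and $\Psi_m:=\sum_{\operatorname{ord}(\zeta)=m}\langle\zeta\rangle$; one has $\Lambda_k=\sum_{m\mid k}\Psi_m$. For a finite set $M\subset\mathbb{N}$ the directed graph $\mathcal{G}(M)$ has vertex set $M$, and there is a directed edge from $m_1$ to $m_2$ (called a $p$-edge) iff $m_1/m_2=p^k$ for a prime $p$ and some $k\ge1$, and there is no $m_3\in M\setminus\{m_1,m_2\}$ with $m_2\mid m_3\mid m_1$. For a prime $p$, the $p$-planes of $\mathcal{G}(M)$ are the connected components of the graph obtained from $\mathcal{G}(M)$ by deleting all $p$-edges. 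-}

module Defs where

open import Data.Nat using (ℕ; zero; suc; _*_; _^_; _≤_; _<_; _≟_; NonZero)
open import Data.Nat.Divisibility using (_∣_)
open import Data.Nat.Coprimality using (Coprime; coprime?)
open import Data.Nat.Primality using (Prime)
open import Data.Integer using (ℤ; 0ℤ; 1ℤ) renaming (_+_ to _+ℤ_; _-_ to _-ℤ_)
open import Data.List using (List; []; _∷_)
open import Data.List.Membership.Propositional using (_∈_)
open import Data.List.Relation.Unary.All using (All)
open import Data.List.Relation.Unary.Linked using (Linked)
open import Data.Product using (Σ; ∃; _×_; _,_)
open import Relation.Nullary using (¬_; yes; no)
open import Relation.Binary.PropositionalEquality using (_≡_; _≢_)
open import Relation.Binary.Construct.Closure.ReflexiveTransitive using (Star)
open import Relation.Binary.Construct.Closure.Symmetric using (SymClosure)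

-- Roots of unity.  A root of unity ζ = e^{2πi num/den} is represented
-- by its reduced fraction num/den with 0 ≤ num < den, gcd(num,den)=1.
-- (This is a bijective encoding of S^UR.)

record RootOfUnity : Set where
  constructor root
  field
    num den   : ℕ
    num<den   : num < den
    reduced   : Coprime num den

open RootOfUnity public

-- Elements of the group ring ℤ⟨S^UR⟩ (all those we use have finite
-- support), viewed as coefficient functions ζ ↦ coefficient of ⟨ζ⟩.
GroupRing : Set
GroupRing = RootOfUnity → ℤ

_≋_ : GroupRing → GroupRing → Set
x ≋ y = ∀ ζ → x ζ ≡ y ζ

zeroGR : GroupRing
zeroGR _ = 0ℤ

_⊕_ : GroupRing → GroupRing → GroupRing
(x ⊕ y) ζ = x ζ +ℤ y ζ

_⊖_ : GroupRing → GroupRing → GroupRing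
(x ⊖ y) ζ = x ζ -ℤ y ζ

-- the basis element ⟨e^{2πi a/m}⟩ (for a < m): its coefficient at ζ is 1
-- iff e^{2πi a/m} = ζ, i.e. a/m = num ζ / den ζ.
⟨e^2πi_/_⟩ : ℕ → ℕ → GroupRing
⟨e^2πi a / m ⟩ ζ with a * den ζ ≟ num ζ * m
... | yes _ = 1ℤ
... | no  _ = 0ℤ

sumBelow : ℕ → (ℕ → GroupRing) → GroupRing
sumBelow zero    f = zeroGR
sumBelow (suc m) f = sumBelow m f ⊕ f m

Λ : ℕ → GroupRing
Λ m = sumBelow m (λ a → ⟨e^2πi a / m ⟩)

-- Ψ_m = Σ_{ord ζ = m} ⟨ζ⟩ ; the roots of unity of order m are exactly
-- e^{2πi a/m} with 0 ≤ a < m, gcd(a,m) = 1.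
Ψ : ℕ → GroupRing
Ψ m = sumBelow m (λ a → term a)
  where
  term : ℕ → GroupRing
  term a with coprime? a m
  ... | yes _ = ⟨e^2πi a / m ⟩
  ... | no  _ = zeroGR

altΛ : List ℕ → GroupRing
altΛ []       = zeroGR
altΛ (k ∷ ks) = Λ k ⊖ altΛ ks

sumΨ : List ℕ → GroupRing
sumΨ []       = zeroGR
sumΨ (m ∷ ms) = Ψ m ⊕ sumΨ ms

-- The directed graph 𝒢(M), M given as a duplicate-free list.

PEdge : ℕ → List ℕ → ℕ → ℕ → Set
PEdge p M m₁ m₂ =
  m₁ ∈ M × m₂ ∈ M × Prime p ×
  (Σ ℕ λ k → 1 ≤ k × m₁ ≡ m₂ * p ^ k) ×
  ¬ (Σ ℕ λ m₃ → m₃ ∈ M × m₃ ≢ m₁ × m₃ ≢ m₂ × m₂ ∣ m₃ × m₃ ∣ m₁)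

Edge : List ℕ → ℕ → ℕ → Set
Edge M m₁ m₂ = Σ ℕ λ p → PEdge p M m₁ m₂

NonPEdge : ℕ → List ℕ → ℕ → ℕ → Set
NonPEdge p M m₁ m₂ = Edge M m₁ m₂ × ¬ PEdge p M m₁ m₂

-- m and m' lie in the same p-plane: same connected component of 𝒢(M)
-- with all p-edges deleted (connectivity ignores edge directions)
SamePPlane : ℕ → List ℕ → ℕ → ℕ → Set
SamePPlane p M = Star (SymClosure (NonPEdge p M))

Property1 : List ℕ → Set
Property1 M = Σ ℕ λ m₁ → m₁ ∈ M × All (λ m → m ≤ m₁) M ×
              All (λ m → Star (Edge M) m₁ m) M

-- Property (2): there is a chain c₀ → c₁ → ... → c_r of 2-edges in 𝒢(M)
-- meeting every 2-plane (every vertex is in the 2-plane of some cᵢ)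
Property2 : List ℕ → Set
Property2 M = Σ ℕ λ c₀ → Σ (List ℕ) λ cs →
  All (_∈ M) (c₀ ∷ cs) ×
  Linked (PEdge 2 M) (c₀ ∷ cs) ×
  All (λ m → Σ ℕ λ c → c ∈ (c₀ ∷ cs) × SamePPlane 2 M c m) M

module Submission where

open import Defs
open import Data.Bool using (Bool; true; false; not; _∧_; _∨_) renaming (_≟_ to _≟ᵇ_)
open import Data.Bool.Properties using (not-involutive; not-injective; ¬-not)
open import Data.Empty using (⊥-elim)
open import Data.Integer using (ℤ; 0ℤ; 1ℤ) renaming (_+_ to _+ℤ_; _-_ to _-ℤ_)
open import Data.List using (List; []; _∷_; map; head)
open import Data.List.Membership.Propositional using (_∈_; _∉_)
open import Data.List.Membership.Propositional.Properties using (∈-map⁺)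
open import Data.List.Relation.Unary.Any using (here; there)
open import Data.List.Relation.Unary.All as All using (All; []; _∷_)
open import Data.List.Relation.Unary.All.Properties using (map⁺)
open import Data.List.Relation.Unary.AllPairs using (_∷_)
open import Data.List.Relation.Unary.Linked as Linked using (Linked; []; [-]; _∷_; _∷′_)
open import Data.List.Relation.Unary.Linked.Properties
  using (Linked⇒All) renaming (map⁺ to linked-map⁺)
open import Data.List.Relation.Unary.Unique.Propositional using (Unique)
open import Data.Maybe using (just)
open import Data.Maybe.Relation.Binary.Connected
  using (Connected; just-nothing) renaming (just to connected)
open import Data.Nat
  using (ℕ; zero; suc; _+_; _*_; _^_; _≤_; _<_; _≟_; NonZero; z≤n; s≤s;
         >-nonZero; ≢-nonZero⁻¹; nonTrivial⇒n>1)
open import Data.Nat.Properties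
open import Data.List.Membership.DecPropositional _≟_ using (_∈?_)
open import Data.Nat.Divisibility
open import Data.Nat.Coprimality as Coprime using (Coprime; coprime?; coprime-divisor; 1-coprimeTo)
open import Data.Nat.Induction using (<-rec)
open import Data.Nat.ListAction using (product)
open import Data.Nat.ListAction.Properties using (∈⇒∣product)
open import Data.Nat.Primality
  using (Prime; prime[2]; euclidsLemma; prime⇒irreducible; prime⇒nonZero; prime⇒nonTrivial)
open import Data.Nat.Primality.Factorisation using (factorise)
open import Data.Product using (Σ; ∃-syntax; _×_; _,_; proj₁)
open import Data.Sum using (_⊎_; inj₁; inj₂; [_,_]′)
open import Function using (_∘_)
open import Relation.Nullary using (¬_; Dec; yes; no; does; ¬?)
open import Relation.Nullary.Decidable using (dec-true; dec-false; decidable-stable; map′)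
open import Relation.Unary using (Decidable)
open import Relation.Binary.PropositionalEquality
open import Relation.Binary.Construct.Closure.ReflexiveTransitive as Star using (Star; ε; _◅_; _◅◅_)
open import Relation.Binary.Construct.Closure.Symmetric using (fwd; symmetric)

-- Comparing coefficients at a root of unity of each order d shows that M is
-- the support of the chain: the d dividing an odd number of the kᵢ (for a
-- divisor chain these kᵢ form an initial segment).  The support has a summit
-- r (after cancelling repeated leading entries, r = k₁): every supported d
-- divides r, and every d ≠ r ascends to a supported d·p^{i+1}.  Going up along
-- powers of p, the first element of M reached is joined to d by a p-edge, so
-- climbing from any d reaches r; this is (1).  For (2), write numbers as
-- 2ᵃ·(odd).  On the layer a, the support agrees with that of the "layer chain"
-- 2ᵃ·oddPart(kᵢ), which has its own summit; climbing there only multiplies by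
-- odd primes, so each layer of M lies in one 2-plane.  An odd o₀ with 2ᵃ·o₀ in
-- the support of every layer a meeting it yields the chain: the supported 2ᵇ·o₀
-- in decreasing order, consecutive ones being joined by 2-edges.

𝟙 : Bool → ℤ
𝟙 true  = 1ℤ
𝟙 false = 0ℤ

𝟙-dec : ∀ {A : Set} {x : ℤ} (a? : Dec A) → (A → x ≡ 1ℤ) → (¬ A → x ≡ 0ℤ) → x ≡ 𝟙 (does a?)
𝟙-dec (yes a) if-yes _      = if-yes a
𝟙-dec (no ¬a) _      if-no = if-no ¬a

𝟙-injective : ∀ b c → 𝟙 b ≡ 𝟙 c → b ≡ c
𝟙-injective true  true  _ = refl
𝟙-injective false false _ = refl

false≢true : false ≢ true
false≢true ()

-- Λ_k − (rest) for a rest supported inside the divisors of k.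
𝟙-minus : ∀ b c → (c ≡ true → b ≡ true) → 𝟙 b -ℤ 𝟙 c ≡ 𝟙 (b ∧ not c)
𝟙-minus true  true  _ = refl
𝟙-minus true  false _ = refl
𝟙-minus false false _ = refl
𝟙-minus false true  c⇒b = ⊥-elim (false≢true (c⇒b refl))

-- Ψ_m + (rest) for a rest not containing m.
𝟙-plus : ∀ {A B : Set} (a? : Dec A) (b? : Dec B) → (A → ¬ B) →
         𝟙 (does a?) +ℤ 𝟙 (does b?) ≡ 𝟙 (does a? ∨ does b?)
𝟙-plus (yes a) (yes b) a⇒¬b = ⊥-elim (a⇒¬b a b)
𝟙-plus (yes _) (no _)  _ = refl
𝟙-plus (no _)  (yes _) _ = refl
𝟙-plus (no _)  (no _)  _ = refl

sumBelow-vanishes : ∀ k (f : ℕ → GroupRing) ζ → (∀ a → a < k → f a ζ ≡ 0ℤ) →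
                    sumBelow k f ζ ≡ 0ℤ
sumBelow-vanishes zero    f ζ h = refl
sumBelow-vanishes (suc k) f ζ h
  rewrite sumBelow-vanishes k f ζ (λ a a<k → h a (m<n⇒m<1+n a<k)) | h k ≤-refl = refl

sumBelow-single : ∀ k (f : ℕ → GroupRing) ζ a₀ → a₀ < k → f a₀ ζ ≡ 1ℤ →
                  (∀ a → a < k → a ≢ a₀ → f a ζ ≡ 0ℤ) → sumBelow k f ζ ≡ 1ℤ
sumBelow-single (suc k) f ζ a₀ a₀<1+k hit miss with a₀ ≟ k
... | yes refl
  rewrite sumBelow-vanishes k f ζ (λ a a<k → miss a (m<n⇒m<1+n a<k) (<⇒≢ a<k)) | hit = refl
... | no a₀≢k
  rewrite sumBelow-single k f ζ a₀ (≤∧≢⇒< (≤-pred a₀<1+k) a₀≢k) hit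
            (λ a a<k → miss a (m<n⇒m<1+n a<k))
        | miss k ≤-refl (≢-sym a₀≢k) = refl

basis-hit : ∀ a m ζ → a * den ζ ≡ num ζ * m → ⟨e^2πi a / m ⟩ ζ ≡ 1ℤ
basis-hit a m ζ e with a * den ζ ≟ num ζ * m
... | yes _  = refl
... | no a≢m = ⊥-elim (a≢m e)

basis-miss : ∀ a m ζ → a * den ζ ≢ num ζ * m → ⟨e^2πi a / m ⟩ ζ ≡ 0ℤ
basis-miss a m ζ ne with a * den ζ ≟ num ζ * m
... | yes e = ⊥-elim (ne e)
... | no  _ = refl

den-nonZero : ∀ ζ → NonZero (den ζ)
den-nonZero ζ = >-nonZero (≤-<-trans z≤n (num<den ζ))

-- If a/m represents ζ then the order of ζ divides m (num ζ / den ζ is reduced).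
den∣ : ∀ a {m} ζ → a * den ζ ≡ num ζ * m → den ζ ∣ m
den∣ a ζ e = coprime-divisor (Coprime.sym (reduced ζ)) (divides a (sym e))

same-numerator : ∀ {a b} ζ → a * den ζ ≡ b * den ζ → a ≡ b
same-numerator {a} {b} ζ = *-cancelʳ-≡ a b (den ζ) {{den-nonZero ζ}}

Λ-coeff : ∀ k .{{_ : NonZero k}} ζ → Λ k ζ ≡ 𝟙 (does (den ζ ∣? k))
Λ-coeff k ζ = 𝟙-dec (den ζ ∣? k) divisor-case λ d∤k →
  sumBelow-vanishes k _ ζ λ a _ → basis-miss a k ζ λ e → d∤k (den∣ a ζ e)
  where
  divisor-case : den ζ ∣ k → Λ k ζ ≡ 1ℤ
  divisor-case (divides q k≡q*d) = sumBelow-single k _ ζ (num ζ * q) a₀<k (basis-hit _ k ζ a₀-hits)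
    (λ a _ a≢a₀ → basis-miss a k ζ λ e → a≢a₀ (same-numerator ζ (trans e (sym a₀-hits))))
    where
    a₀-hits : num ζ * q * den ζ ≡ num ζ * k
    a₀-hits = begin
      num ζ * q * den ζ   ≡⟨ *-assoc (num ζ) q (den ζ) ⟩
      num ζ * (q * den ζ) ≡⟨ cong (num ζ *_) k≡q*d ⟨
      num ζ * k           ∎
      where open ≡-Reasoning
    a₀<k : num ζ * q < k
    a₀<k = subst (num ζ * q <_) (trans (*-comm (den ζ) q) (sym k≡q*d))
             (*-monoˡ-< q {{quotient≢0 (divides q k≡q*d)}} (num<den ζ))

-- The summands of Ψ_m are local to its definition in Defs; we name them
-- through the definitional equation Ψ m = sumBelow m (Ψ-summand m).
Ψ-as-sum : Σ (ℕ → ℕ → GroupRing) λ T → ∀ m → Ψ m ≡ sumBelow m (T m)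
Ψ-as-sum = _ , λ m → refl

Ψ-summand : ℕ → ℕ → GroupRing
Ψ-summand = proj₁ Ψ-as-sum

Ψ-summand-coprime : ∀ m a ζ → Coprime a m → Ψ-summand m a ζ ≡ ⟨e^2πi a / m ⟩ ζ
Ψ-summand-coprime m a ζ c with coprime? a m
... | yes _  = refl
... | no ¬c = ⊥-elim (¬c c)

Ψ-summand-miss : ∀ m a ζ → (Coprime a m → a * den ζ ≢ num ζ * m) → Ψ-summand m a ζ ≡ 0ℤ
Ψ-summand-miss m a ζ miss with coprime? a m
... | yes c = basis-miss a m ζ (miss c)
... | no  _ = refl

Ψ-coeff : ∀ m ζ → Ψ m ζ ≡ 𝟙 (does (den ζ ≟ m))
Ψ-coeff m ζ = 𝟙-dec (den ζ ≟ m) order-m λ d≢m →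
  sumBelow-vanishes m (Ψ-summand m) ζ λ a _ → Ψ-summand-miss m a ζ λ c e →
    d≢m (∣-antisym (den∣ a ζ e) (coprime-divisor (Coprime.sym c) (divides (num ζ) e)))
  where
  order-m : den ζ ≡ m → Ψ m ζ ≡ 1ℤ
  order-m refl = sumBelow-single m (Ψ-summand m) ζ (num ζ) (num<den ζ)
    (trans (Ψ-summand-coprime m (num ζ) ζ (reduced ζ)) (basis-hit (num ζ) m ζ refl))
    (λ a _ a≢num → Ψ-summand-miss m a ζ λ _ e → a≢num (same-numerator ζ e))

∣-nonZero : ∀ {d n} .{{_ : NonZero n}} → d ∣ n → NonZero d
∣-nonZero {zero}  {n} d∣n = ⊥-elim (≢-nonZero⁻¹ n (0∣⇒≡0 d∣n))
∣-nonZero {suc d}     _   = _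

prime>1 : ∀ {p} → Prime p → 1 < p
prime>1 {p} pp = nonTrivial⇒n>1 p {{prime⇒nonTrivial pp}}

prime-divisor : ∀ n → 1 < n → ∃[ p ] Prime p × p ∣ n
prime-divisor n@(suc _) 1<n with factorise n
... | record { factors = [] ; isFactorisation = n≡1 } = ⊥-elim (<-irrefl (sym n≡1) 1<n)
... | record { factors = p ∷ ps ; isFactorisation = n≡p*ps ; factorsPrime = pp ∷ _ } =
  p , pp , divides (product ps) (trans n≡p*ps (*-comm p (product ps)))

prime-step : ∀ {d k} .{{_ : NonZero k}} → d ∣ k → d ≢ k → ∃[ p ] Prime p × d * p ^ 1 ∣ k
prime-step {d} {k} d∣k@(divides q k≡q*d) d≢k
  with prime-divisor q (quotient>1 d∣k (≤∧≢⇒< (∣⇒≤ d∣k) d≢k))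
... | p , pp , p∣q = p , pp ,
  subst (_∣ k) (cong (d *_) (sym (*-identityʳ p))) (subst (d * p ∣_) k≡d*q (*-monoʳ-∣ d p∣q))
  where
  k≡d*q : d * q ≡ k
  k≡d*q = trans (*-comm d q) (sym k≡q*d)

prime∤⇒coprime : ∀ {p u} → Prime p → ¬ p ∣ u → Coprime u p
prime∤⇒coprime pp p∤u (d∣u , d∣p) with prime⇒irreducible pp d∣p
... | inj₁ d≡1 = d≡1
... | inj₂ refl = ⊥-elim (p∤u d∣u)

∣p^i⇒≡p^j : ∀ {p} → Prime p → ∀ i {u} → u ∣ p ^ i → ∃[ j ] j ≤ i × u ≡ p ^ j
∣p^i⇒≡p^j pp zero u∣1 = 0 , z≤n , ∣1⇒≡1 u∣1
∣p^i⇒≡p^j {p} pp (suc i) {u} u∣p^1+i with p ∣? u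
... | no p∤u =
  let j , j≤i , u≡p^j = ∣p^i⇒≡p^j pp i (coprime-divisor (prime∤⇒coprime pp p∤u) u∣p^1+i)
  in j , m≤n⇒m≤1+n j≤i , u≡p^j
... | yes (divides q refl) =
  let j , j≤i , q≡p^j = ∣p^i⇒≡p^j pp i
        (*-cancelˡ-∣ p {{prime⇒nonZero pp}} (subst (_∣ p * p ^ i) (*-comm q p) u∣p^1+i))
  in suc j , s≤s j≤i , trans (*-comm q p) (cong (p *_) q≡p^j)

between-d-dp^i : ∀ {p} → Prime p → ∀ {d} .{{_ : NonZero d}} i {m} → d ∣ m → m ∣ d * p ^ i →
                 ∃[ j ] j ≤ i × m ≡ d * p ^ j
between-d-dp^i {p} pp {d} i (divides q refl) q*d∣d*p^i =
  let j , j≤i , q≡p^j = ∣p^i⇒≡p^j pp i (*-cancelˡ-∣ d (subst (_∣ d * p ^ i) (*-comm q d) q*d∣d*p^i))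
  in j , j≤i , trans (*-comm q d) (cong (d *_) q≡p^j)

n<p^n : ∀ {p} → 1 < p → ∀ n → n < p ^ n
n<p^n 1<p zero    = s≤s z≤n
n<p^n {p} 1<p (suc n) = begin-strict
  suc n       ≤⟨ n<p^n 1<p n ⟩
  p ^ n       <⟨ m<m*n (p ^ n) p {{m^n≢0 p n {{>-nonZero (<-trans (s≤s z≤n) 1<p)}}}} 1<p ⟩
  p ^ n * p   ≡⟨ *-comm (p ^ n) p ⟩
  p * p ^ n   ∎
  where open ≤-Reasoning

coprime-∣⇒*∣ : ∀ {x y n} → Coprime x y → x ∣ n → y ∣ n → x * y ∣ n
coprime-∣⇒*∣ {x} {y} c (divides q refl) y∣q*x =
  let divides r q≡r*y = coprime-divisor (Coprime.sym c) (subst (y ∣_) (*-comm q x) y∣q*x)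
  in divides r (begin
    q * x       ≡⟨ cong (_* x) q≡r*y ⟩
    r * y * x   ≡⟨ *-assoc r y x ⟩
    r * (y * x) ≡⟨ cong (r *_) (*-comm y x) ⟩
    r * (x * y) ∎)
  where open ≡-Reasoning

module _ {P : ℕ → Set} (P? : Decidable P) where

  private
    search : ∀ n → (∃[ j ] j < n × P j × (∀ {j'} → j' < j → ¬ P j')) ⊎ (∀ {j} → j < n → ¬ P j)
    search zero = inj₂ λ ()
    search (suc n) with search n
    ... | inj₁ (j , j<n , Pj , below) = inj₁ (j , m<n⇒m<1+n j<n , Pj , below)
    ... | inj₂ none with P? n
    ...   | yes Pn = inj₁ (n , ≤-refl , Pn , none)
    ...   | no ¬Pn = inj₂ λ j<1+n → [ none , (λ { refl → ¬Pn }) ]′ (m<1+n⇒m<n∨m≡n j<1+n)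

  least : ∀ {i} → P i → ∃[ j ] j ≤ i × P j × (∀ {j'} → j' < j → ¬ P j')
  least {i} Pi with search (suc i)
  ... | inj₁ (j , j<1+i , Pj , below) = j , ≤-pred j<1+i , Pj , below
  ... | inj₂ none = ⊥-elim (none ≤-refl Pi)

largest-power : ∀ {q x n} .{{_ : NonZero n}} → Prime q → x ∣ n →
                ∃[ e ] x * q ^ e ∣ n × ¬ x * q ^ suc e ∣ n
largest-power {q} {x} {n} pq x∣n with least (λ j → ¬? (x * q ^ suc j ∣? n)) {n} too-big
  where
  too-big : ¬ x * q ^ suc n ∣ n
  too-big h = <⇒≱ (n<p^n (prime>1 pq) (suc n))
    (≤-trans (m≤n*m (q ^ suc n) x {{∣-nonZero x∣n}}) (≤-trans (∣⇒≤ h) (n≤1+n n)))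
... | zero  , _ , ∤ , _     = 0 , subst (_∣ n) (sym (*-identityʳ x)) x∣n , ∤
... | suc e , _ , ∤ , below = suc e , decidable-stable (x * q ^ suc e ∣? n) (below ≤-refl) , ∤

*-^-suc : ∀ x p e → x * p ^ e * p ^ 1 ≡ x * p ^ suc e
*-^-suc x p e = begin
  x * p ^ e * p ^ 1   ≡⟨ *-assoc x (p ^ e) (p ^ 1) ⟩
  x * (p ^ e * p ^ 1) ≡⟨ cong (x *_) (^-distribˡ-+-* p e 1) ⟨
  x * p ^ (e + 1)     ≡⟨ cong (λ t → x * p ^ t) (+-comm e 1) ⟩
  x * p ^ suc e       ∎
  where open ≡-Reasoning

escape : ∀ {d k k'} .{{_ : NonZero k}} → d ∣ k → d ≢ k → k' ∣ k → k' ≢ k →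
         ∃[ p ] ∃[ i ] Prime p × d * p ^ suc i ∣ k × ¬ d * p ^ suc i ∣ k'
escape {d} {k} {k'} d∣k d≢k k'∣k k'≢k with d ∣? k'
... | no d∤k' =
  let p , pp , dp∣k = prime-step d∣k d≢k
  in p , 0 , pp , dp∣k , d∤k' ∘ ∣-trans (m∣m*n (p ^ 1))
... | yes d∣k' =
  let q , pq , k'q∣k = prime-step k'∣k k'≢k
      e , dqᵉ∣k' , dq¹⁺ᵉ∤k' = largest-power {{∣-nonZero k'∣k}} pq d∣k'
  in q , e , pq , ∣-trans (subst (_∣ k' * q ^ 1) (*-^-suc d q e) (*-monoˡ-∣ (q ^ 1) dqᵉ∣k')) k'q∣k ,
     dq¹⁺ᵉ∤k'

<-*-prime-power : ∀ {p} d .{{_ : NonZero d}} → Prime p → ∀ j → d < d * p ^ suc j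
<-*-prime-power {p} d pp j = m<m*n d (p ^ suc j) (<-≤-trans (prime>1 pp)
  (subst (_≤ p ^ suc j) (*-identityʳ p) (*-monoʳ-≤ p (m^n>0 p {{prime⇒nonZero pp}} j))))

2^-shift : ∀ b o n → 2 ^ b * o * 2 ^ n ≡ 2 ^ (b + n) * o
2^-shift b o n = begin
  2 ^ b * o * 2 ^ n     ≡⟨ *-assoc (2 ^ b) o (2 ^ n) ⟩
  2 ^ b * (o * 2 ^ n)   ≡⟨ cong (2 ^ b *_) (*-comm o (2 ^ n)) ⟩
  2 ^ b * (2 ^ n * o)   ≡⟨ *-assoc (2 ^ b) (2 ^ n) o ⟨
  2 ^ b * 2 ^ n * o     ≡⟨ cong (_* o) (^-distribˡ-+-* 2 b n) ⟨
  2 ^ (b + n) * o       ∎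
  where open ≡-Reasoning

-- For a divisor chain k₁, k₂, … the entries divisible by d form an initial
-- segment; parity ks d records whether that segment has odd length.
parity : List ℕ → ℕ → Bool
parity []       d = false
parity (k ∷ ks) d = does (d ∣? k) ∧ not (parity ks d)

DivisorChain : List ℕ → Set
DivisorChain = Linked (λ kprev k → k ∣ kprev)

chain-∣head : ∀ {k ks} → DivisorChain (k ∷ ks) → All (_∣ k) (k ∷ ks)
chain-∣head = Linked⇒All (λ y∣x z∣y → ∣-trans z∣y y∣x) ∣-refl

parity-flip : ∀ {k ks d} → d ∣ k → parity (k ∷ ks) d ≡ not (parity ks d)
parity-flip {k} {ks} {d} d∣k = cong (_∧ not (parity ks d)) (dec-true (d ∣? k) d∣k)

parity-∤ : ∀ {k ks d} → ¬ d ∣ k → parity (k ∷ ks) d ≡ false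
parity-∤ {k} {ks} {d} d∤k = cong (_∧ not (parity ks d)) (dec-false (d ∣? k) d∤k)

-- The orders d at which Λ_{k₁} − Λ_{k₂} + … has coefficient 1.  (A record,
-- so that ks and d can be recovered from a proof.)
record Supp (ks : List ℕ) (d : ℕ) : Set where
  constructor odd-parity
  field
    parity-odd : parity ks d ≡ true

open Supp

supp-[] : ∀ {d} → ¬ Supp [] d
supp-[] (odd-parity ())

supp-∣ : ∀ {k ks d} → Supp (k ∷ ks) d → d ∣ k
supp-∣ {k} {ks} {d} s = decidable-stable (d ∣? k) λ d∤k →
  false≢true (trans (sym (parity-∤ {ks = ks} d∤k)) (parity-odd s))

supp-∤ : ∀ {k ks d} → ¬ d ∣ k → ¬ Supp (k ∷ ks) d
supp-∤ d∤k s = d∤k (supp-∣ s)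

supp-cons : ∀ {k ks d} → d ∣ k → ¬ Supp ks d → Supp (k ∷ ks) d
supp-cons {ks = ks} d∣k ¬s =
  odd-parity (trans (parity-flip {ks = ks} d∣k) (cong not (¬-not (¬s ∘ odd-parity))))

supp-tail : ∀ {k ks d} → Supp (k ∷ ks) d → ¬ Supp ks d
supp-tail {ks = ks} s t = false≢true
  (trans (sym (trans (parity-flip {ks = ks} (supp-∣ s)) (cong not (parity-odd t)))) (parity-odd s))

supp-flip : ∀ {k ks d} → d ∣ k → ¬ Supp (k ∷ ks) d → Supp ks d
supp-flip {ks = ks} d∣k ¬s =
  odd-parity (not-injective (trans (sym (parity-flip {ks = ks} d∣k)) (¬-not (¬s ∘ odd-parity))))

supp-nonZero : ∀ {ks d} → All NonZero ks → Supp ks d → NonZero d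
supp-nonZero (nz ∷ _) s = ∣-nonZero {{nz}} (supp-∣ s)

chain-supp-∣ : ∀ {k ks d} → DivisorChain (k ∷ ks) → Supp ks d → d ∣ k
chain-supp-∣ {ks = _ ∷ _} (k'∣k ∷ _) s = ∣-trans (supp-∣ s) k'∣k

chain-parity-∤ : ∀ {k ks d} → DivisorChain (k ∷ ks) → ¬ d ∣ k → parity ks d ≡ false
chain-parity-∤ {ks = ks} {d} ch d∤k with parity ks d in s
... | false = refl
... | true  = ⊥-elim (d∤k (chain-supp-∣ ch (odd-parity s)))

parity-repeat : ∀ {k ks} → DivisorChain (k ∷ k ∷ ks) → ∀ d → parity (k ∷ k ∷ ks) d ≡ parity ks d
parity-repeat {k} {ks} ch d with d ∣? k
... | yes _  = not-involutive (parity ks d)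
... | no d∤k = sym (chain-parity-∤ (Linked.tail ch) d∤k)

supp-transport : ∀ {ks ks' d} → parity ks d ≡ parity ks' d → Supp ks d → Supp ks' d
supp-transport same (odd-parity s) = odd-parity (trans (sym same) s)

supp? : ∀ ks d → Dec (Supp ks d)
supp? ks d = map′ odd-parity parity-odd (parity ks d ≟ᵇ true)

altΛ-coeff : ∀ ks → All NonZero ks → DivisorChain ks → ∀ ζ → altΛ ks ζ ≡ 𝟙 (parity ks (den ζ))
altΛ-coeff []       _          _  ζ = refl
altΛ-coeff (k ∷ ks) (nz ∷ nzs) ch ζ = begin
  Λ k ζ -ℤ altΛ ks ζ
    ≡⟨ cong₂ _-ℤ_ (Λ-coeff k {{nz}} ζ) (altΛ-coeff ks nzs (Linked.tail ch) ζ) ⟩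
  𝟙 (does (den ζ ∣? k)) -ℤ 𝟙 (parity ks (den ζ))
    ≡⟨ 𝟙-minus _ _ (λ s → dec-true (den ζ ∣? k) (chain-supp-∣ ch (odd-parity s))) ⟩
  𝟙 (parity (k ∷ ks) (den ζ)) ∎
  where open ≡-Reasoning

sumΨ-coeff : ∀ M → Unique M → ∀ ζ → sumΨ M ζ ≡ 𝟙 (does (den ζ ∈? M))
sumΨ-coeff []      _           ζ = refl
sumΨ-coeff (m ∷ M) (m∉M ∷ uniq) ζ = begin
  Ψ m ζ +ℤ sumΨ M ζ
    ≡⟨ cong₂ _+ℤ_ (Ψ-coeff m ζ) (sumΨ-coeff M uniq ζ) ⟩
  𝟙 (does (den ζ ≟ m)) +ℤ 𝟙 (does (den ζ ∈? M))
    ≡⟨ 𝟙-plus (den ζ ≟ m) (den ζ ∈? M) (λ { refl i → All.lookup m∉M i refl }) ⟩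
  𝟙 (does (den ζ ∈? m ∷ M)) ∎
  where open ≡-Reasoning

primitiveRoot : ∀ d → .{{NonZero d}} → RootOfUnity
primitiveRoot 1             = root 0 1 (s≤s z≤n) (Coprime.sym (1-coprimeTo 0))
primitiveRoot (suc (suc n)) = root 1 (suc (suc n)) (s≤s (s≤s z≤n)) (1-coprimeTo _)

den-primitiveRoot : ∀ d .{{_ : NonZero d}} → den (primitiveRoot d) ≡ d
den-primitiveRoot 1             = refl
den-primitiveRoot (suc (suc n)) = refl

-- Comparing coefficients at a root of each order d: the hypothesis of the
-- theorem says precisely that M lists the support of the alternating sum.
support-is-M : ∀ ks → All NonZero ks → DivisorChain ks → ∀ M → Unique M →
               altΛ ks ≋ sumΨ M → ∀ d → .{{NonZero d}} → parity ks d ≡ does (d ∈? M)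
support-is-M ks nzks ch M uniq eq d = 𝟙-injective _ _ (begin
  𝟙 (parity ks d)            ≡⟨ cong (λ x → 𝟙 (parity ks x)) (den-primitiveRoot d) ⟨
  𝟙 (parity ks (den ζ))      ≡⟨ altΛ-coeff ks nzks ch ζ ⟨
  altΛ ks ζ                  ≡⟨ eq ζ ⟩
  sumΨ M ζ                   ≡⟨ sumΨ-coeff M uniq ζ ⟩
  𝟙 (does (den ζ ∈? M))      ≡⟨ cong (λ x → 𝟙 (does (x ∈? M))) (den-primitiveRoot d) ⟩
  𝟙 (does (d ∈? M))          ∎)
  where
  open ≡-Reasoning
  ζ = primitiveRoot d

record Enumerates (M ks : List ℕ) : Set where
  field
    ∈⇒supp : ∀ {d} → d ∈ M → Supp ks d
    supp⇒∈ : ∀ {d} → Supp ks d → d ∈ M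

enumerates : ∀ ks → All NonZero ks → DivisorChain ks → ∀ M → Unique M → All NonZero M →
             altΛ ks ≋ sumΨ M → Enumerates M ks
enumerates ks nzks ch M uniq nzM eq = record
  { ∈⇒supp = λ {d} d∈M → odd-parity
      (trans (support-is-M ks nzks ch M uniq eq d {{All.lookup nzM d∈M}}) (dec-true (d ∈? M) d∈M))
  ; supp⇒∈ = λ {d} s → decidable-stable (d ∈? M) λ d∉M → false≢true (begin
      false             ≡⟨ dec-false (d ∈? M) d∉M ⟨
      does (d ∈? M)     ≡⟨ support-is-M ks nzks ch M uniq eq d {{supp-nonZero nzks s}} ⟨
      parity ks d       ≡⟨ parity-odd s ⟩
      true              ∎)
  }
  where open ≡-Reasoning

record Summit (ks : List ℕ) : Set where
  field
    top      : ℕ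
    top-supp : Supp ks top
    ∣top     : ∀ {d} → Supp ks d → d ∣ top
    ascend   : ∀ {d} → Supp ks d → d ≢ top → ∃[ p ] ∃[ i ] Prime p × Supp ks (d * p ^ suc i)

summit-transport : ∀ {ks ks'} → (∀ d → parity ks d ≡ parity ks' d) → Summit ks' → Summit ks
summit-transport same S = record
  { top      = top
  ; top-supp = supp-transport (sym (same _)) top-supp
  ; ∣top     = ∣top ∘ supp-transport (same _)
  ; ascend   = λ s d≢top → let p , i , pp , s' = ascend (supp-transport (same _) s) d≢top
                           in p , i , pp , supp-transport (sym (same _)) s'
  }
  where open Summit S

-- A divisor chain with non-empty support has a summit: after cancelling
-- repeated leading entries it is the first entry.
summit : ∀ {ks d} → All NonZero ks → DivisorChain ks → Supp ks d → Summit ks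
summit {[]} _ _ (odd-parity ())
summit {k ∷ []} (nz ∷ _) _ _ = record
  { top      = k
  ; top-supp = supp-cons ∣-refl supp-[]
  ; ∣top     = supp-∣
  ; ascend   = λ s d≢k → let p , pp , dp∣k = prime-step {{nz}} (supp-∣ s) d≢k
                         in p , 0 , pp , supp-cons dp∣k supp-[]
  }
summit {k ∷ k' ∷ ks} (nz ∷ _ ∷ nzs) ch@(k'∣k ∷ ch') s with k ≟ k'
... | yes refl =
  summit-transport (parity-repeat ch)
    (summit nzs (Linked.tail ch') (supp-transport (parity-repeat ch _) s))
... | no k≢k' = record
  { top      = k
  ; top-supp = supp-cons ∣-refl (supp-∤ λ k∣k' → k≢k' (∣-antisym k∣k' k'∣k))
  ; ∣top     = supp-∣
  ; ascend   = λ s d≢k → let p , i , pp , ∣k , ∤k' = escape {{nz}} (supp-∣ s) d≢k k'∣k (k≢k' ∘ sym)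
                         in p , i , pp , supp-cons ∣k (supp-∤ ∤k')
  }

-- d·p^{j+1} → d is a p-edge of 𝒢(M) as soon as no d·p^{j'+1} with j' < j
-- lies in M: the only candidates for an intermediate vertex are of that form.
p-edge : ∀ {M p d} j .{{_ : NonZero d}} → Prime p → d ∈ M → d * p ^ suc j ∈ M →
         (∀ {j'} → j' < j → d * p ^ suc j' ∉ M) → PEdge p M (d * p ^ suc j) d
p-edge {M} {p} {d} j pp d∈M top∈M gap = top∈M , d∈M , pp , (suc j , s≤s z≤n , refl) , no-between
  where
  no-between : ¬ (Σ ℕ λ m₃ → m₃ ∈ M × m₃ ≢ d * p ^ suc j × m₃ ≢ d × d ∣ m₃ × m₃ ∣ d * p ^ suc j)
  no-between (m₃ , m₃∈M , m₃≢top , m₃≢d , d∣m₃ , m₃∣top) with between-d-dp^i pp (suc j) d∣m₃ m₃∣top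
  ... | zero   , _         , m₃≡d = m₃≢d (trans m₃≡d (*-identityʳ d))
  ... | suc j₃ , s≤s j₃≤j , m₃≡ with j₃ ≟ j
  ...   | yes refl = m₃≢top m₃≡
  ...   | no j₃≢j  = gap (≤∧≢⇒< j₃≤j j₃≢j) (subst (_∈ M) m₃≡ m₃∈M)

first-p-edge : ∀ {M p d i} .{{_ : NonZero d}} → Prime p → d ∈ M → d * p ^ suc i ∈ M →
               ∃[ j ] j ≤ i × d * p ^ suc j ∈ M × PEdge p M (d * p ^ suc j) d
first-p-edge {M} {p} {d} pp d∈M hit with least (λ j → d * p ^ suc j ∈? M) hit
... | j , j≤i , hitʲ , below = j , j≤i , hitʲ , p-edge j pp d∈M hitʲ below

climb : ∀ {T : ℕ → Set} {E : ℕ → ℕ → Set} {r B : ℕ} → (∀ {d} → T d → d ≤ B) →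
        (∀ {d} → T d → d ≢ r → ∃[ d' ] T d' × d < d' × E d' d) →
        ∀ {d} → T d → Star E r d
climb {T} {E} {r} {B} bounded step = go (suc B) (m≤n+m (suc B) _)
  where
  go : ∀ n {d} → B < d + n → T d → Star E r d
  go zero    {d} B<d+0 Td = ⊥-elim (<⇒≱ (subst (B <_) (+-identityʳ d) B<d+0) (bounded Td))
  go (suc n) {d} B<d+1+n Td with d ≟ r
  ... | yes refl = ε
  ... | no d≢r =
    let d' , Td' , d<d' , e = step Td d≢r
        B<d'+n = <-≤-trans B<d+1+n (subst (_≤ d' + n) (sym (+-suc d n)) (+-monoˡ-≤ n d<d'))
    in go n B<d'+n Td' ◅◅ (e ◅ ε)

Odd : ℕ → Set
Odd o = ¬ 2 ∣ o

odd-1 : Odd 1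
odd-1 = 1+n≰n ∘ ∣⇒≤

odd-* : ∀ {m n} → Odd m → Odd n → Odd (m * n)
odd-* {m} {n} odd-m odd-n 2∣mn = [ odd-m , odd-n ]′ (euclidsLemma m n prime[2] 2∣mn)

odd-^ : ∀ {p} → Odd p → ∀ n → Odd (p ^ n)
odd-^ _     zero    = odd-1
odd-^ odd-p (suc n) = odd-* odd-p (odd-^ odd-p n)

odd-coprime-2^ : ∀ {o} → Odd o → ∀ a → Coprime o (2 ^ a)
odd-coprime-2^ odd a (d∣o , d∣2^a) with ∣p^i⇒≡p^j prime[2] a d∣2^a
... | zero  , _ , d≡1  = d≡1
... | suc j , _ , refl = ⊥-elim (odd (∣-trans (m∣m*n (2 ^ j)) d∣o))

record TwoAdic (n : ℕ) : Set where
  field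
    exponent : ℕ
    odd-part : ℕ
    odd      : Odd odd-part
    splits   : n ≡ 2 ^ exponent * odd-part

twoAdic : ∀ n → .{{NonZero n}} → TwoAdic n
twoAdic = <-rec (λ n → .{{NonZero n}} → TwoAdic n) halve
  where
  halve : ∀ n → (∀ {m} → m < n → .{{NonZero m}} → TwoAdic m) → .{{NonZero n}} → TwoAdic n
  halve n rec with 2 ∣? n
  ... | no odd = record { exponent = 0 ; odd-part = n ; odd = odd ; splits = sym (+-identityʳ n) }
  ... | yes 2∣n@(divides q n≡q*2) = record
    { exponent = suc exponent
    ; odd-part = odd-part
    ; odd      = odd
    ; splits   = begin
        n                       ≡⟨ n≡q*2 ⟩
        q * 2                   ≡⟨ *-comm q 2 ⟩
        2 * q                   ≡⟨ cong (2 *_) splits ⟩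
        2 * (2 ^ exponent * odd-part) ≡⟨ *-assoc 2 (2 ^ exponent) odd-part ⟨
        2 ^ suc exponent * odd-part   ∎
    }
    where
    instance
      q≢0 : NonZero q
      q≢0 = quotient≢0 2∣n
    open ≡-Reasoning
    open TwoAdic (rec (subst (q <_) (sym n≡q*2) (m<m*n q 2 (s≤s (s≤s z≤n)))))

-- The odd part of n (with oddPart 0 = 0, never used).
oddPart : ℕ → ℕ
oddPart zero        = zero
oddPart n@(suc _)   = TwoAdic.odd-part (twoAdic n)

oddPart-odd : ∀ n .{{_ : NonZero n}} → Odd (oddPart n)
oddPart-odd n@(suc _) = TwoAdic.odd (twoAdic n)

oddPart-splits : ∀ n .{{_ : NonZero n}} → ∃[ a ] n ≡ 2 ^ a * oddPart n
oddPart-splits n@(suc _) = TwoAdic.exponent (twoAdic n) , TwoAdic.splits (twoAdic n)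

oddPart-∣ : ∀ n .{{_ : NonZero n}} → oddPart n ∣ n
oddPart-∣ n = let a , n≡ = oddPart-splits n in divides (2 ^ a) n≡

odd-∣⇒∣oddPart : ∀ {o} n .{{_ : NonZero n}} → Odd o → o ∣ n → o ∣ oddPart n
odd-∣⇒∣oddPart n odd o∣n =
  let a , n≡ = oddPart-splits n in coprime-divisor (odd-coprime-2^ odd a) (subst (_ ∣_) n≡ o∣n)

data Layer (a : ℕ) : ℕ → Set where
  layer : ∀ {o} → Odd o → Layer a (2 ^ a * o)

layer-exponent< : ∀ {a d} .{{_ : NonZero d}} → Layer a d → a < d
layer-exponent< {a} (layer {o} _) = <-≤-trans (n<p^n (s≤s (s≤s z≤n)) a) (∣⇒≤ (m∣m*n o))

layer-of : ∀ d .{{_ : NonZero d}} → ∃[ a ] Layer a d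
layer-of d = let a , d≡ = oddPart-splits d in a , subst (Layer a) (sym d≡) (layer (oddPart-odd d))

layer-*odd : ∀ {a d m} → Layer a d → Odd m → Layer a (d * m)
layer-*odd {a} {m = m} (layer {o} odd-o) odd-m =
  subst (Layer a) (sym (*-assoc (2 ^ a) o m)) (layer (odd-* odd-o odd-m))

layer-∣⇒ : ∀ a {o} k .{{_ : NonZero k}} → Odd o → 2 ^ a * o ∣ k → o ∣ oddPart k
layer-∣⇒ a k odd 2ᵃo∣k = odd-∣⇒∣oddPart k odd (∣-trans (n∣m*n (2 ^ a)) 2ᵃo∣k)

layer-∣⇐ : ∀ a {o} k .{{_ : NonZero k}} → Odd o → 2 ^ a ∣ k → o ∣ oddPart k → 2 ^ a * o ∣ k
layer-∣⇐ a k odd 2ᵃ∣k o∣k' =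
  coprime-∣⇒*∣ (Coprime.sym (odd-coprime-2^ odd a)) 2ᵃ∣k (∣-trans o∣k' (oddPart-∣ k))

same-layer⇒¬2-edge : ∀ {M a m₁ m₂} → Layer a m₁ → Layer a m₂ → ¬ PEdge 2 M m₁ m₂
same-layer⇒¬2-edge {a = a} (layer {o₁} odd₁) (layer {o₂} _) (_ , _ , _ , (suc k , _ , m₁≡) , _) =
  odd₁ (divides (o₂ * 2 ^ k) (begin
    o₁               ≡⟨ *-cancelˡ-≡ o₁ _ (2 ^ a) {{m^n≢0 2 a}} (trans m₁≡ (*-assoc (2 ^ a) o₂ _)) ⟩
    o₂ * (2 * 2 ^ k) ≡⟨ cong (o₂ *_) (*-comm 2 (2 ^ k)) ⟩
    o₂ * (2 ^ k * 2) ≡⟨ *-assoc o₂ (2 ^ k) 2 ⟨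
    o₂ * 2 ^ k * 2   ∎))
  where open ≡-Reasoning

layerChain : ℕ → List ℕ → List ℕ
layerChain a []       = []
layerChain a (k ∷ ks) with 2 ^ a ∣? k
... | yes _ = 2 ^ a * oddPart k ∷ layerChain a ks
... | no  _ = []

layerChain-nonZero : ∀ a {ks} → All NonZero ks → All NonZero (layerChain a ks)
layerChain-nonZero a {[]}     _          = []
layerChain-nonZero a {k ∷ ks} (nz ∷ nzs) with 2 ^ a ∣? k
... | yes _ = m*n≢0 (2 ^ a) (oddPart k) {{m^n≢0 2 a}} {{∣-nonZero {{nz}} (oddPart-∣ k {{nz}})}}
              ∷ layerChain-nonZero a nzs
... | no  _ = []

layerChain-chain : ∀ a {ks} → All NonZero ks → DivisorChain ks → DivisorChain (layerChain a ks)
layerChain-chain a {[]} _ _ = []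
layerChain-chain a {k ∷ []} _ _ with 2 ^ a ∣? k
... | yes _ = [-]
... | no  _ = []
layerChain-chain a {k ∷ k' ∷ ks} (nz ∷ nz' ∷ nzs) (k'∣k ∷ ch) with 2 ^ a ∣? k
... | no  _ = []
... | yes _ with 2 ^ a ∣? k' | layerChain-chain a (nz' ∷ nzs) ch
...   | no  _ | _  = [-]
...   | yes _ | ih =
  *-monoʳ-∣ (2 ^ a) (odd-∣⇒∣oddPart k {{nz}} (oddPart-odd k' {{nz'}})
                       (∣-trans (oddPart-∣ k' {{nz'}}) k'∣k)) ∷ ih

layerChain-odd : ∀ a {ks y} → All NonZero ks → Supp (layerChain a ks) (2 ^ a * y) → Odd y
layerChain-odd a {k ∷ ks} {y} (nz ∷ _) s with 2 ^ a ∣? k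
... | yes _ = λ 2∣y → oddPart-odd k {{nz}}
                (∣-trans 2∣y (*-cancelˡ-∣ (2 ^ a) {{m^n≢0 2 a}} (supp-∣ s)))
... | no  _ = ⊥-elim (false≢true (parity-odd s))

layerChain-ascent-odd : ∀ a {ks o p i} → All NonZero ks →
                        Supp (layerChain a ks) (2 ^ a * o * p ^ suc i) → Odd p
layerChain-ascent-odd a {o = o} {p} {i} nzks s 2∣p =
  layerChain-odd a nzks (subst (Supp _) (*-assoc (2 ^ a) o _) s)
    (∣-trans 2∣p (∣n⇒∣m*n o (m∣m*n (p ^ i))))

layerChain-parity : ∀ a {ks d} → All NonZero ks → Layer a d →
                    parity ks d ≡ parity (layerChain a ks) d
layerChain-parity a {[]} _ _ = refl
layerChain-parity a {k ∷ ks} {d} (nz ∷ nzs) l@(layer {o} odd) with 2 ^ a ∣? k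
... | no 2ᵃ∤k = parity-∤ {ks = ks} λ d∣k → 2ᵃ∤k (∣-trans (m∣m*n o) d∣k)
... | yes 2ᵃ∣k = cong₂ (λ b c → b ∧ not c) same-divisibility (layerChain-parity a nzs l)
  where
  instance _ = nz
  same-divisibility : does (d ∣? k) ≡ does (d ∣? 2 ^ a * oddPart k)
  same-divisibility with d ∣? k | d ∣? 2 ^ a * oddPart k
  ... | yes _   | yes _   = refl
  ... | no  _   | no  _   = refl
  ... | yes d∣k | no  d∤  = ⊥-elim (d∤ (*-monoʳ-∣ (2 ^ a) (layer-∣⇒ a k odd d∣k)))
  ... | no  d∤k | yes d∣  =
    ⊥-elim (d∤k (layer-∣⇐ a k odd 2ᵃ∣k (*-cancelˡ-∣ (2 ^ a) {{m^n≢0 2 a}} d∣)))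

supp-to-layer : ∀ a {ks d} → All NonZero ks → Layer a d → Supp ks d → Supp (layerChain a ks) d
supp-to-layer a nzks l = supp-transport (layerChain-parity a nzks l)

supp-from-layer : ∀ a {ks d} → All NonZero ks → Layer a d → Supp (layerChain a ks) d → Supp ks d
supp-from-layer a nzks l = supp-transport (sym (layerChain-parity a nzks l))

ColumnBase : List ℕ → ℕ → Set
ColumnBase ks o₀ = ∀ {a d} → Layer a d → Supp ks d → Supp ks (2 ^ a * o₀)

head-base : ∀ {k ks} .{{_ : NonZero k}} → (∀ a → ¬ Supp ks (2 ^ a * oddPart k)) →
            ColumnBase (k ∷ ks) (oddPart k)
head-base {k} tail-misses {a} (layer {o} _) s =
  supp-cons (layer-∣⇐ a k (oddPart-odd k) (∣-trans (m∣m*n o) (supp-∣ s)) ∣-refl) (tail-misses a)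

skip-base : ∀ {k k' ks o₀} .{{_ : NonZero k}} .{{_ : NonZero k'}} → oddPart k ≡ oddPart k' →
            DivisorChain (k ∷ k' ∷ ks) → Odd o₀ → o₀ ∣ k' → ColumnBase ks o₀ →
            ColumnBase (k ∷ k' ∷ ks) o₀
skip-base {k} {k'} {o₀ = o₀} op≡op' (k'∣k ∷ ch') odd₀ o₀∣k' base {a} l@(layer {o} odd) s
  with 2 ^ a ∣? k'
... | yes 2ᵃ∣k' =
  -- d also divides k', so it is supported by the rest, and so is 2ᵃ·o₀
  let d∣k' = layer-∣⇐ a k' odd 2ᵃ∣k' (subst (o ∣_) op≡op' (layer-∣⇒ a k odd (supp-∣ s)))
      c-supp = base l (supp-flip d∣k' (supp-tail s))
  in supp-cons (∣-trans (chain-supp-∣ ch' c-supp) k'∣k) (λ t → supp-tail t c-supp)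
... | no 2ᵃ∤k' = supp-cons
  (layer-∣⇐ a k odd₀ (∣-trans (m∣m*n o) (supp-∣ s)) (odd-∣⇒∣oddPart k odd₀ (∣-trans o₀∣k' k'∣k)))
  (supp-∤ (2ᵃ∤k' ∘ ∣-trans (m∣m*n o₀)))

column-base : ∀ ks → All NonZero ks → DivisorChain ks → ∀ {K} → All (_∣ K) ks →
              ∃[ o₀ ] Odd o₀ × o₀ ∣ K × ColumnBase ks o₀
column-base [] _ _ {K} _ = 1 , odd-1 , 1∣ K , λ _ → ⊥-elim ∘ supp-[]
column-base (k ∷ []) (nz ∷ _) _ (k∣K ∷ _) =
  oddPart k , oddPart-odd k , ∣-trans (oddPart-∣ k) k∣K , head-base (λ _ → supp-[])
  where instance _ = nz
column-base (k ∷ k' ∷ ks) (nz ∷ nz' ∷ nzs) ch@(k'∣k ∷ ch') (k∣K ∷ _) with oddPart k ≟ oddPart k'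
... | no op≢op' = oddPart k , oddPart-odd k , ∣-trans (oddPart-∣ k) k∣K , head-base tail-misses
  where
  instance _ = nz
  instance _ = nz'
  tail-misses : ∀ a → ¬ Supp (k' ∷ ks) (2 ^ a * oddPart k)
  tail-misses a s = op≢op' (∣-antisym (layer-∣⇒ a k' (oddPart-odd k) (supp-∣ s))
    (odd-∣⇒∣oddPart k (oddPart-odd k') (∣-trans (oddPart-∣ k') k'∣k)))
... | yes op≡op' with column-base ks nzs (Linked.tail ch') (All.tail (chain-∣head ch'))
...   | o₀ , odd₀ , o₀∣k' , base =
  o₀ , odd₀ , ∣-trans o₀∣k' (∣-trans k'∣k k∣K) , skip-base {{nz}} {{nz'}} op≡op' ch odd₀ o₀∣k' base

module _ {Q : ℕ → Set} (Q? : Decidable Q) where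

  hitsBelow : ℕ → List ℕ
  hitsBelow zero    = []
  hitsBelow (suc n) with Q? n
  ... | yes _ = n ∷ hitsBelow n
  ... | no  _ = hitsBelow n

  NextHit : ℕ → ℕ → Set
  NextHit b b' = Q b × Q b' × b' < b × (∀ {c} → b' < c → c < b → ¬ Q c)

  hits-Q : ∀ n → All Q (hitsBelow n)
  hits-Q zero = []
  hits-Q (suc n) with Q? n
  ... | yes Qn = Qn ∷ hits-Q n
  ... | no  _  = hits-Q n

  hits-complete : ∀ {n b} → b < n → Q b → b ∈ hitsBelow n
  hits-complete {suc n} {b} b<1+n Qb with Q? n | m<1+n⇒m<n∨m≡n b<1+n
  ... | yes _  | inj₂ refl = here refl
  ... | yes _  | inj₁ b<n  = there (hits-complete b<n Qb)
  ... | no ¬Qn | inj₂ refl = ⊥-elim (¬Qn Qb)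
  ... | no _   | inj₁ b<n  = hits-complete b<n Qb

  private
    next-hit : ∀ n {m} → Q m → n ≤ m → (∀ {c} → n ≤ c → c < m → ¬ Q c) →
               Connected NextHit (just m) (head (hitsBelow n))
    next-hit zero    _  _   _   = just-nothing
    next-hit (suc n) Qm n<m gap with Q? n
    ... | yes Qn = connected (Qm , Qn , n<m , gap)
    ... | no ¬Qn = next-hit n Qm (<⇒≤ n<m) λ n≤c c<m →
      [ (λ n<c → gap n<c c<m) , (λ { refl → ¬Qn }) ]′ (m≤n⇒m<n∨m≡n n≤c)

  hits-linked : ∀ n → Linked NextHit (hitsBelow n)
  hits-linked zero = []
  hits-linked (suc n) with Q? n
  ... | yes Qn = next-hit n Qn ≤-refl (λ n≤c c<n → ⊥-elim (<⇒≱ c<n n≤c)) ∷′ hits-linked n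
  ... | no  _  = hits-linked n

module _ {ks M : List ℕ} (nzks : All NonZero ks) (ch : DivisorChain ks)
         (enum : Enumerates M ks) where
  open Enumerates enum

  supp-nz : ∀ {d} → Supp ks d → NonZero d
  supp-nz = supp-nonZero nzks

  ≤summit : (S : Summit ks) → ∀ {d} → Supp ks d → d ≤ Summit.top S
  ≤summit S s = ∣⇒≤ {{supp-nz (Summit.top-supp S)}} (Summit.∣top S s)

  ascend-edge : ∀ {p d i} → Prime p → Supp ks d → Supp ks (d * p ^ suc i) →
                ∃[ j ] j ≤ i × Supp ks (d * p ^ suc j) × d < d * p ^ suc j ×
                       PEdge p M (d * p ^ suc j) d
  ascend-edge {d = d} pp s s' =
    let j , j≤i , hit , e = first-p-edge {{supp-nz s}} pp (supp⇒∈ s) (supp⇒∈ s')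
    in j , j≤i , ∈⇒supp hit , <-*-prime-power d {{supp-nz s}} pp j , e

  property1 : Summit ks → Property1 M
  property1 S = top , supp⇒∈ top-supp , All.tabulate (≤summit S ∘ ∈⇒supp) ,
                All.tabulate (climb (≤summit S) step ∘ ∈⇒supp)
    where
    open Summit S
    step : ∀ {d} → Supp ks d → d ≢ top → ∃[ d' ] Supp ks d' × d < d' × Edge M d' d
    step s d≢top =
      let p , i , pp , s' = ascend s d≢top
          j , _ , sʲ , d<dpʲ , e = ascend-edge {i = i} pp s s'
      in _ , sʲ , d<dpʲ , p , e

  -- Inside layer a, the summit of the layer chain reaches every supported
  -- vertex of the layer along edges that are not 2-edges: the primes used
  -- for climbing are odd, so the climb never leaves the layer.
  layer-reach : ∀ a (S : Summit (layerChain a ks)) {d} → Supp ks d → Layer a d →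
                Star (NonPEdge 2 M) (Summit.top S) d
  layer-reach a S s l = climb {T = λ d → Supp ks d × Layer a d} bounded step (s , l)
    where
    open Summit S
    bounded : ∀ {d} → Supp ks d × Layer a d → d ≤ top
    bounded (s , l) =
      ∣⇒≤ {{supp-nonZero (layerChain-nonZero a nzks) top-supp}} (∣top (supp-to-layer a nzks l s))
    step : ∀ {d} → Supp ks d × Layer a d → d ≢ top →
           ∃[ d' ] (Supp ks d' × Layer a d') × d < d' × NonPEdge 2 M d' d
    step (s , l@(layer {o} _)) d≢top with ascend (supp-to-layer a nzks l s) d≢top
    ... | p , i , pp , sᵢ with layerChain-ascent-odd a {p = p} {i} nzks sᵢ
    ...   | odd-p
      with ascend-edge {i = i} pp s
             (supp-from-layer a nzks (layer-*odd {a} l (odd-^ odd-p (suc i))) sᵢ)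
    ...     | j , _ , sⱼ , d<d' , e =
      _ , (sⱼ , layerⱼ) , d<d' , (p , e) , same-layer⇒¬2-edge {a = a} layerⱼ l
      where
      layerⱼ : Layer a (2 ^ a * o * p ^ suc j)
      layerⱼ = layer-*odd {a} l (odd-^ odd-p (suc j))

  layer-plane : ∀ {a d d'} → Layer a d → Layer a d' → Supp ks d → Supp ks d' → SamePPlane 2 M d d'
  layer-plane {a} l l' s s' =
    Star.reverse (symmetric _) (Star.map fwd (layer-reach a S s l)) ◅◅
    Star.map fwd (layer-reach a S s' l')
    where
    S = summit (layerChain-nonZero a nzks) (layerChain-chain a nzks ch) (supp-to-layer a nzks l s)

  column-edge : ∀ {o₀ b b'} → NextHit (λ b → supp? ks (2 ^ b * o₀)) b b' →
                PEdge 2 M (2 ^ b * o₀) (2 ^ b' * o₀)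
  column-edge {o₀} {b' = b'} (s , s' , b'<b , gap) with m≤n⇒∃[o]m+o≡n b'<b
  ... | j , refl = subst (λ x → PEdge 2 M x (2 ^ b' * o₀)) (step j)
    (p-edge j {{supp-nz s'}} prime[2] (supp⇒∈ s') (subst (_∈ M) (sym (step j)) (supp⇒∈ s))
      λ {j'} j'<j t → gap (s≤s (m≤m+n b' j')) (+-monoʳ-< (suc b') j'<j)
                          (∈⇒supp (subst (_∈ M) (step j') t)))
    where
    step : ∀ j → 2 ^ b' * o₀ * 2 ^ suc j ≡ 2 ^ (suc b' + j) * o₀
    step j = trans (2^-shift b' o₀ (suc j)) (cong (λ t → 2 ^ t * o₀) (+-suc b' j))

  property2-intro : ∀ {cs m} → m ∈ M → All (_∈ M) cs → Linked (PEdge 2 M) cs →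
                    (∀ {m} → m ∈ M → ∃[ c ] c ∈ cs × SamePPlane 2 M c m) → Property2 M
  property2-intro {[]} m∈M _ _ meets with meets m∈M
  ... | _ , () , _
  property2-intro {c₀ ∷ cs} _ inM linked meets = c₀ , cs , inM , linked , All.tabulate meets

  -- Property (2): for a column base o₀, the supported 2ᵇ·o₀ with b ≤ top (the
  -- summit), in decreasing order, form a chain of 2-edges; it meets the
  -- 2-plane of each m ∈ M, of layer a say, in 2ᵃ·o₀.
  property2 : Summit ks → ∀ {m} → m ∈ M → Property2 M
  property2 S m∈M with column-base ks nzks ch (All.tabulate ∈⇒∣product)
  ... | o₀ , odd₀ , _ , base = property2-intro m∈M
    (map⁺ (All.map supp⇒∈ (hits-Q Q? (suc top))))
    (linked-map⁺ (Linked.map column-edge (hits-linked Q? (suc top))))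
    meets
    where
    open Summit S using (top)
    Q? : ∀ b → Dec (Supp ks (2 ^ b * o₀))
    Q? b = supp? ks (2 ^ b * o₀)
    column : List ℕ
    column = map (λ b → 2 ^ b * o₀) (hitsBelow Q? (suc top))
    meets : ∀ {m} → m ∈ M → ∃[ c ] c ∈ column × SamePPlane 2 M c m
    meets {m} m∈M =
      let s = ∈⇒supp m∈M
          a , l = layer-of m {{supp-nz s}}
          a≤top = <⇒≤ (<-≤-trans (layer-exponent< {{supp-nz s}} l) (≤summit S s))
      in 2 ^ a * o₀ , ∈-map⁺ (λ b → 2 ^ b * o₀) (hits-complete Q? (s≤s a≤top) (base l s)) ,
         layer-plane (layer odd₀) l (base l s) s

lemma6p8 : (ks : List ℕ) → All NonZero ks → Linked (λ kprev k → k ∣ kprev) ks →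
           (M : List ℕ) → Unique M → All NonZero M →
           altΛ ks ≋ sumΨ M →
           M ≡ [] ⊎ (Property1 M × Property2 M)
lemma6p8 ks nzks ch []        _    _   _  = inj₁ refl
lemma6p8 ks nzks ch M@(_ ∷ _) uniq nzM eq =
  inj₂ (property1 nzks ch enum S , property2 nzks ch enum S (here refl))
  where
  enum = enumerates ks nzks ch M uniq nzM eq
  S = summit nzks ch (Enumerates.∈⇒supp enum (here refl))
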